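{- Let $u, v\in\Sigma^\star$ be finite words, let $i_1, i_2 \in [1,|u|]$, $j_1, j_2 \in [1,|v|]$, and $n \in \mathbb N$. The following are equivalent: (i) (a) $R_n(u) = R_n(v)$; (b) for all $r \in R_n^\star(u)$ and $r' \in R_{n-1}^\star(u)$, $\mathrm{ord}(r(u), r'(u)) = \mathrm{ord}(r(v), r'(v))$; (c) $(u, i_1, i_2) \equiv^2_0 (v, j_1, j_2)$; (d) for all $r \in R_n^\star(u)$, $\mathrm{ord}(i_1, r(u)) = \mathrm{ord}(j_1, r(v))$ and $\mathrm{ord}(i_2, r(u)) = \mathrm{ord}(j_2, r(v))$; (ii) $(u, i_1, i_2) \equiv^2_n (v, j_1, j_2)$.
   Context: $\Sigma$ is a finite alphabet. A word $w=w_1\cdots w_{|w|}\in\Sigma^\star$ is identified with the structure with universe $\{1,\dots,|w|\}$, linear order $<$, and unary relations $Q_{\mathtt a}=\{i:w_i=\mathtt a\}$, $\mathtt a\in\Sigma$; $(w,i,j)$ denotes it with variable $x$ interpreted as $i$ and $y$ as $j$. $\mathrm{FO}^2_n[<]$ is the set of first-order formulas over this vocabulary using only variables $x,y$ (which may be requantified) with quantifier depth at most $n$; $(u,i_1,i_2)\equiv^2_n(v,j_1,j_2)$ means the two structures satisfy the same $\mathrm{FO}^2_n[<]$ formulas (free variables among $x,y$); in particular $\equiv^2_0$ means agreement on all quantifier-free formulas. A boundary position is a symbol $d_{\mathtt a}$ with $d\in\{\triangleright,\triangleleft\}$, $\mathtt a\in\Sigma$; $\triangleright_{\mathtt a}(w)=\min\{i\in[1,|w|]: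 w_i=\mathtt a\}$, $\triangleleft_{\mathtt a}(w)=\max\{i\in[1,|w|]: w_i=\mathtt a\}$, and relative to a position $q$: $\triangleright_{\mathtt a}(w,q)=\min\{i\in[q+1,|w|]: w_i=\mathtt a\}$, $\triangleleft_{\mathtt a}(w,q)=\max\{i\in[1,q-1]: w_i=\mathtt a\}$ (min/max of the empty set undefined). An $n$-ranker $r=(p_1,\dots,p_n)$ is a sequence of $n$ boundary positions with $r(w)=p_1(w)$ if $n=1$, $r(w)$ undefined if $(p_1,\dots,p_{n-1})(w)$ is undefined, and otherwise $r(w)=p_n(w,(p_1,\dots,p_{n-1})(w))$. $R_n(w)$ is the set of $n$-rankers defined on $w$, $R_n^\star(w)=\bigcup_{i\in[1,n]}R_i(w)$. $\mathrm{ord}(i,j)\in\{<,=,>\}$ is the order type of $i,j$. -}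

module Defs where

open import Data.Nat using (ℕ; zero; suc; _+_; _≤_; _<ᵇ_; _≡ᵇ_)
open import Data.Fin using (Fin)
open import Data.Fin.Properties using () renaming (_≟_ to _≟F_)
open import Data.Bool using (Bool; true; false; _∧_; _∨_; not)
open import Data.List using (List; []; _∷_; length; map; upTo; filterᵇ; head; last)
open import Data.Bool.ListAction using (any; all)
open import Data.Maybe using (Maybe; just; nothing; _>>=_)
open import Data.Product using (∃; _×_)
open import Relation.Nullary.Decidable using (⌊_⌋)
open import Relation.Binary.PropositionalEquality using (_≡_)
open import Function.Bundles using (_⇔_)

-- Words over the finite alphabet Σ = Fin k; positions are 1-indexed.

Word : ℕ → Set
Word k = List (Fin k)

letterAt : ∀ {k} → Word k → ℕ → Maybe (Fin k)
letterAt []       _             = nothing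
letterAt (c ∷ w)  zero          = nothing
letterAt (c ∷ w)  (suc zero)    = just c
letterAt (c ∷ w)  (suc (suc i)) = letterAt w (suc i)

isLetter : ∀ {k} → Word k → Fin k → ℕ → Bool
isLetter w a i with letterAt w i
... | nothing = false
... | just c  = ⌊ c ≟F a ⌋

positions : ∀ {k} → Word k → List ℕ
positions w = map suc (upTo (length w))

data Dir : Set where
  ▷ ◁ : Dir

BPos : ℕ → Set
BPos k = Dir × Fin k

firstAfter : ∀ {k} → Word k → Fin k → ℕ → Maybe ℕ
firstAfter w a q = head (filterᵇ (λ i → (q <ᵇ i) ∧ isLetter w a i) (positions w))

lastBefore : ∀ {k} → Word k → Fin k → ℕ → Maybe ℕ
lastBefore w a q = last (filterᵇ (λ i → (i <ᵇ q) ∧ isLetter w a i) (positions w))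

stepRel : ∀ {k} → Word k → BPos k → ℕ → Maybe ℕ
stepRel w (▷ Data.Product., a) q = firstAfter w a q
stepRel w (◁ Data.Product., a) q = lastBefore w a q

stepAbs : ∀ {k} → Word k → BPos k → Maybe ℕ
stepAbs w (▷ Data.Product., a) = firstAfter w a 0
stepAbs w (◁ Data.Product., a) = lastBefore w a (suc (length w))

-- a ranker is a list of boundary positions; an n-ranker has length n
Ranker : ℕ → Set
Ranker k = List (BPos k)

evalFrom : ∀ {k} → Word k → Ranker k → ℕ → Maybe ℕ
evalFrom w []       q = just q
evalFrom w (p ∷ ps) q = stepRel w p q >>= evalFrom w ps

-- r(w) (undefined = nothing); the empty sequence is never defined
eval : ∀ {k} → Ranker k → Word k → Maybe ℕ
eval []       w = nothing
eval (p ∷ ps) w = stepAbs w p >>= evalFrom w ps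

Defined : ∀ {k} → Ranker k → Word k → Set
Defined r w = ∃ λ p → eval r w ≡ just p

InR : ∀ {k} → ℕ → Word k → Ranker k → Set
InR n w r = length r ≡ n × Defined r w

InR* : ∀ {k} → ℕ → Word k → Ranker k → Set
InR* n w r = (1 ≤ length r × length r ≤ n) × Defined r w

data OrdT : Set where
  lt eq gt : OrdT

ord : ℕ → ℕ → OrdT
ord i j with i <ᵇ j | i ≡ᵇ j
... | true  | _     = lt
... | false | true  = eq
... | false | false = gt

ordM : Maybe ℕ → Maybe ℕ → Maybe OrdT
ordM (just i) (just j) = just (ord i j)
ordM _        _        = nothing

data Var : Set where
  x y : Var

data FO2 (k : ℕ) : Set where
  tt ff   : FO2 k
  _<'_    : Var → Var → FO2 k
  _='_    : Var → Var → FO2 k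
  Q       : Fin k → Var → FO2 k
  ¬'_     : FO2 k → FO2 k
  _∧'_    : FO2 k → FO2 k → FO2 k
  _∨'_    : FO2 k → FO2 k → FO2 k
  ∃'      : Var → FO2 k → FO2 k
  ∀'      : Var → FO2 k → FO2 k

qd : ∀ {k} → FO2 k → ℕ
qd tt        = 0
qd ff        = 0
qd (_ <' _)  = 0
qd (_ =' _)  = 0
qd (Q _ _)   = 0
qd (¬' φ)    = qd φ
qd (φ ∧' ψ)  = qd φ Data.Nat.⊔ qd ψ
qd (φ ∨' ψ)  = qd φ Data.Nat.⊔ qd ψ
qd (∃' _ φ)  = suc (qd φ)
qd (∀' _ φ)  = suc (qd φ)

val : Var → ℕ → ℕ → ℕ
val x i j = i
val y i j = j

upd : Var → ℕ → ℕ → ℕ → ℕ × ℕ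
upd x p i j = p Data.Product., j
upd y p i j = i Data.Product., p

sat : ∀ {k} → Word k → ℕ → ℕ → FO2 k → Bool
sat w i j tt       = true
sat w i j ff       = false
sat w i j (a <' b) = val a i j <ᵇ val b i j
sat w i j (a =' b) = val a i j ≡ᵇ val b i j
sat w i j (Q c a)  = isLetter w c (val a i j)
sat w i j (¬' φ)   = not (sat w i j φ)
sat w i j (φ ∧' ψ) = sat w i j φ ∧ sat w i j ψ
sat w i j (φ ∨' ψ) = sat w i j φ ∨ sat w i j ψ
sat w i j (∃' a φ) = any (λ p → sat w (Data.Product.proj₁ (upd a p i j)) (Data.Product.proj₂ (upd a p i j)) φ) (positions w)
sat w i j (∀' a φ) = all (λ p → sat w (Data.Product.proj₁ (upd a p i j)) (Data.Product.proj₂ (upd a p i j)) φ) (positions w)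

FOEquiv : ∀ {k} → ℕ → Word k → ℕ → ℕ → Word k → ℕ → ℕ → Set
FOEquiv n u i₁ i₂ v j₁ j₂ = ∀ φ → qd φ ≤ n → sat u i₁ i₂ φ ≡ sat v j₁ j₂ φ

CondI : ∀ {k} → ℕ → Word k → ℕ → ℕ → Word k → ℕ → ℕ → Set
CondI n u i₁ i₂ v j₁ j₂ =
  (∀ r → InR n u r ⇔ InR n v r)
  × (∀ r r' → InR* n u r → InR* (n Data.Nat.∸ 1) u r' →
       ordM (eval r u) (eval r' u) ≡ ordM (eval r v) (eval r' v))
  × FOEquiv 0 u i₁ i₂ v j₁ j₂
  × (∀ r → InR* n u r →
       ordM (just i₁) (eval r u) ≡ ordM (just j₁) (eval r v)
       × ordM (just i₂) (eval r u) ≡ ordM (just j₂) (eval r v))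

module Submission where

-- (i) ⇒ (ii) runs through the Ehrenfeucht–Fraïssé game for FO²: surviving n rounds implies ≡²_n
-- (game⇒equiv), and condition (i) is a winning position (invariant⇒game).  When spoiler moves a
-- pebble to p in u, duplicator answers with the other pebble if p lies on it, with r(v) if p = r(u)
-- for a shorter ranker r, and otherwise with the value in v of the cell ranker of p: from the
-- nearest shorter-ranker value beyond p step back to the nearest occurrence of p's letter.  Condition
-- (i) one level lower then holds after the move (forth); moves in v use its symmetry (invariant-sym).
--
-- (ii) ⇒ (i) holds because rankers are FO²-definable: r has formulas of depth |r| saying that r is
-- defined and on which side of r(w) a variable lies; putting the formulas of r' in place of the
-- variable in the last step of r compares r(w) with r'(w) at depth max(|r|, |r'| + 1).
--
-- Both directions rest on one description of boundary positions: (d , a) at q is the nearest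
-- a-position beyond q in direction d (Nearest), which also yields the nearest values used by cells.

open import Defs
open import Data.Nat using (ℕ; zero; suc; _+_; _∸_; _≤_; _<_; _<ᵇ_; _≡ᵇ_; z≤n; s≤s)
open import Data.Nat.Properties
open import Data.List.Properties using (length-++)
open import Data.Fin using (Fin)
import Data.Maybe.Properties
open import Data.Bool using (Bool; true; false; _∧_; _∨_; not; T)
open import Data.Bool.Properties using (T-∧)
open import Data.Bool.ListAction using (any; all)
open import Data.Unit using (tt)
open import Data.Empty using (⊥-elim)
open import Data.Maybe using (Maybe; just; nothing; _>>=_)
open import Data.Product using (∃-syntax; _×_; _,_; proj₁; proj₂)
open import Data.Sum using (_⊎_; inj₁; inj₂)
import Data.Sum
open import Data.List using (List; []; _∷_; length; filterᵇ; head; last; _++_; allFin; cartesianProduct; cartesianProductWith)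
open import Data.List.Membership.Propositional using (_∈_; find; lose)
open import Data.List.Membership.Propositional.Properties
  using (∈-map⁻; ∈-map⁺; ∈-upTo⁺; ∈-upTo⁻; ∈-filter⁺; ∈-filter⁻; ∈-allFin; ∈-cartesianProduct⁺; ∈-cartesianProductWith⁺)
open import Data.List.Relation.Unary.Any using (here; there; any?)
open import Data.List.Relation.Unary.Any.Properties using (any⇔)
import Data.List.Relation.Unary.All as All
open import Data.List.Relation.Unary.AllPairs using (AllPairs; _∷_)
import Data.List.Relation.Unary.AllPairs.Properties as AllPairs
open import Relation.Nullary using (¬_; Dec; yes; no; _×-dec_)
open import Relation.Binary.Definitions using (tri<; tri≈; tri>)
open import Relation.Nullary.Decidable using (T?; ⌊_⌋; toWitness; fromWitness)
open import Relation.Binary.PropositionalEquality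
open import Function using (_∘_; id)
open import Function.Bundles using (_⇔_; mk⇔; Equivalence)

open Equivalence using (to; from)

private
  variable
    k : ℕ

T-ext : ∀ {a b} → T a ⇔ T b → a ≡ b
T-ext {false} {false} _ = refl
T-ext {false} {true}  h = ⊥-elim (from h tt)
T-ext {true}  {false} h = ⊥-elim (to h tt)
T-ext {true}  {true}  _ = refl

T-not⇔ : ∀ {b} → T (not b) ⇔ (¬ T b)
T-not⇔ {false} = mk⇔ (λ _ ()) (λ _ → tt)
T-not⇔ {true}  = mk⇔ (λ ()) (λ ¬t → ¬t tt)

all⇔ : ∀ {A : Set} (g : A → Bool) xs → T (all g xs) ⇔ (∀ x → x ∈ xs → T (g x))
all⇔ g [] = mk⇔ (λ _ _ ()) (λ _ → tt)
all⇔ g (a ∷ as) = mk⇔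
  (λ t → let ga , gas = to (T-∧ {g a}) t in λ { _ (here refl) → ga ; z (there z∈) → to (all⇔ g as) gas z z∈ })
  (λ h → from T-∧ (h a (here refl) , from (all⇔ g as) (λ z z∈ → h z (there z∈))))

Pos : Word k → ℕ → Set
Pos w p = 1 ≤ p × p ≤ length w

∈-positions : ∀ (w : Word k) {p} → p ∈ positions w ⇔ Pos w p
∈-positions w = mk⇔ forward backward
  where
  forward : ∀ {p} → p ∈ positions w → Pos w p
  forward p∈ with i , i∈ , refl ← ∈-map⁻ suc p∈ = s≤s z≤n , ∈-upTo⁻ i∈
  backward : ∀ {p} → Pos w p → p ∈ positions w
  backward {suc i} (_ , i<n) = ∈-map⁺ suc (∈-upTo⁺ i<n)

positions-ascending : ∀ (w : Word k) → AllPairs _<_ (positions w)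
positions-ascending w =
  AllPairs.map⁺ (AllPairs.applyUpTo⁺₁ id (length w) (λ i<j _ → s≤s i<j))

any-positions : ∀ (w : Word k) (g : ℕ → Bool) → T (any g (positions w)) ⇔ (∃[ p ] Pos w p × T (g p))
any-positions w g = mk⇔
  (λ t → let p , p∈ , gp = find (from any⇔ t) in p , to (∈-positions w) p∈ , gp)
  (λ (p , pp , gp) → to any⇔ (lose (from (∈-positions w) pp) gp))

all-positions : ∀ (w : Word k) (g : ℕ → Bool) → T (all g (positions w)) ⇔ (∀ p → Pos w p → T (g p))
all-positions w g = mk⇔
  (λ t p pp → to (all⇔ g (positions w)) t p (from (∈-positions w) pp))
  (λ h → from (all⇔ g (positions w)) (λ p p∈ → h p (to (∈-positions w) p∈)))

Letter : Word k → Fin k → ℕ → Set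
Letter w a i = letterAt w i ≡ just a

letter⇒Pos : ∀ (w : Word k) {c} i → letterAt w i ≡ just c → Pos w i
letter⇒Pos (_ ∷ _) (suc zero) _ = s≤s z≤n , s≤s z≤n
letter⇒Pos (_ ∷ w) (suc (suc i)) e = s≤s z≤n , s≤s (proj₂ (letter⇒Pos w (suc i) e))

Pos⇒letter : ∀ (w : Word k) i → Pos w i → ∃[ c ] letterAt w i ≡ just c
Pos⇒letter (c ∷ _) (suc zero) _ = c , refl
Pos⇒letter (_ ∷ w) (suc (suc i)) (_ , s≤s i≤n) = Pos⇒letter w (suc i) (s≤s z≤n , i≤n)

isLetter⇔ : ∀ (w : Word k) a i → T (isLetter w a i) ⇔ Letter w a i
isLetter⇔ w a i with letterAt w i
... | nothing = mk⇔ (λ ()) (λ ())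
... | just c  = mk⇔ (cong just ∘ toWitness) (fromWitness ∘ Data.Maybe.Properties.just-injective)

only-position : ∀ (w : Word k) {i} → length w ≤ 1 → Pos w i → i ≡ 1
only-position w |w|≤1 (1≤i , i≤|w|) = ≤-antisym (≤-trans i≤|w| |w|≤1) 1≤i

_≺[_]_ : ℕ → Dir → ℕ → Set
i ≺[ ▷ ] j = i < j
i ≺[ ◁ ] j = j < i

≺-irrefl : ∀ d {i} → ¬ i ≺[ d ] i
≺-irrefl ▷ = <-irrefl refl
≺-irrefl ◁ = <-irrefl refl

opposite : Dir → Dir
opposite ▷ = ◁
opposite ◁ = ▷

≺-opposite : ∀ d {i j} → i ≺[ opposite d ] j ⇔ j ≺[ d ] i
≺-opposite ▷ = mk⇔ id id
≺-opposite ◁ = mk⇔ id id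

≺-≼-trans : ∀ d {a b c} → a ≺[ d ] b → ¬ c ≺[ d ] b → a ≺[ d ] c
≺-≼-trans ▷ a<b c≮b = <-≤-trans a<b (≮⇒≥ c≮b)
≺-≼-trans ◁ b<a b≮c = ≤-<-trans (≮⇒≥ b≮c) b<a

≼-≺-trans : ∀ d {a b c} → ¬ b ≺[ d ] a → b ≺[ d ] c → a ≺[ d ] c
≼-≺-trans ▷ b≮a b<c = ≤-<-trans (≮⇒≥ b≮a) b<c
≼-≺-trans ◁ a≮b c<b = <-≤-trans c<b (≮⇒≥ a≮b)

≺-connex : ∀ d {i j} → i ≢ j → i ≺[ d ] j ⊎ j ≺[ d ] i
≺-connex ▷ {i} {j} i≢j with <-cmp i j
... | tri< i<j _ _ = inj₁ i<j
... | tri≈ _ i≡j _ = ⊥-elim (i≢j i≡j)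
... | tri> _ _ j<i = inj₂ j<i
≺-connex ◁ i≢j = Data.Sum.swap (≺-connex ▷ i≢j)

≺? : ∀ d i j → Dec (i ≺[ d ] j)
≺? ▷ i j = i <? j
≺? ◁ i j = j <? i

direction : ∀ {s p} → s ≢ p → ∃[ d ] s ≺[ d ] p
direction s≢p with ≺-connex ▷ s≢p
... | inj₁ s<p = ▷ , s<p
... | inj₂ p<s = ◁ , p<s

head-least : ∀ {xs : List ℕ} {t} → AllPairs _<_ xs → head xs ≡ just t → t ∈ xs × (∀ {z} → z ∈ xs → t ≤ z)
head-least (t<xs ∷ _) refl = here refl , λ { (here refl) → ≤-refl ; (there z∈) → <⇒≤ (All.lookup t<xs z∈) }

last-greatest : ∀ {xs : List ℕ} {t} → AllPairs _<_ xs → last xs ≡ just t → t ∈ xs × (∀ {z} → z ∈ xs → z ≤ t)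
last-greatest {_ ∷ []} _ refl = here refl , λ { (here refl) → ≤-refl }
last-greatest {a ∷ b ∷ xs} (a<bxs ∷ bxs↑) e =
  let t∈ , greatest = last-greatest bxs↑ e
  in there t∈ , λ { (here refl) → <⇒≤ (<-≤-trans (All.lookup a<bxs (here refl)) (greatest (here refl)))
                  ; (there z∈) → greatest z∈ }

beyondᵇ : Dir → ℕ → ℕ → Bool
beyondᵇ ▷ q i = q <ᵇ i
beyondᵇ ◁ q i = i <ᵇ q

beyondᵇ⇔ : ∀ d q i → T (beyondᵇ d q i) ⇔ q ≺[ d ] i
beyondᵇ⇔ ▷ q i = mk⇔ (<ᵇ⇒< q i) <⇒<ᵇ
beyondᵇ⇔ ◁ q i = mk⇔ (<ᵇ⇒< i q) <⇒<ᵇ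

extreme : Dir → List ℕ → Maybe ℕ
extreme ▷ = head
extreme ◁ = last

extreme-spec : ∀ d {xs t} → AllPairs _<_ xs → extreme d xs ≡ just t → t ∈ xs × (∀ {z} → z ∈ xs → ¬ z ≺[ d ] t)
extreme-spec ▷ xs↑ e = let t∈ , least = head-least xs↑ e in t∈ , ≤⇒≯ ∘ least
extreme-spec ◁ xs↑ e = let t∈ , greatest = last-greatest xs↑ e in t∈ , ≤⇒≯ ∘ greatest

extreme-nothing : ∀ d {xs : List ℕ} → extreme d xs ≡ nothing → ∀ {z} → ¬ z ∈ xs
extreme-nothing ▷ {[]} _ ()
extreme-nothing ◁ {[]} _ ()
extreme-nothing ◁ {_ ∷ b ∷ xs} e _ = extreme-nothing ◁ {b ∷ xs} e (here refl)

select : Word k → (ℕ → Bool) → List ℕ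
select w g = filterᵇ g (positions w)

∈-select : ∀ (w : Word k) g {i} → i ∈ select w g ⇔ (Pos w i × T (g i))
∈-select w g = mk⇔
  (λ i∈ → let i∈w , gi = ∈-filter⁻ (T? ∘ g) i∈ in to (∈-positions w) i∈w , gi)
  (λ (pi , gi) → ∈-filter⁺ (T? ∘ g) (from (∈-positions w) pi) gi)

select-ascending : ∀ (w : Word k) g → AllPairs _<_ (select w g)
select-ascending w g = AllPairs.filter⁺ (T? ∘ g) (positions-ascending w)

nearestIn : Word k → Dir → ℕ → (ℕ → Bool) → Maybe ℕ
nearestIn w d q g = extreme d (select w (λ i → beyondᵇ d q i ∧ g i))

record NearestBy (d : Dir) (w : Word k) (g : ℕ → Bool) (q t : ℕ) : Set where
  field
    beyond   : q ≺[ d ] t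
    passes   : T (g t)
    nearest  : ∀ {p} → Pos w p → q ≺[ d ] p → T (g p) → ¬ p ≺[ d ] t

∈-beyond : ∀ (w : Word k) d q (g : ℕ → Bool) {i} →
  i ∈ select w (λ i → beyondᵇ d q i ∧ g i) ⇔ (Pos w i × q ≺[ d ] i × T (g i))
∈-beyond w d q g {i} = mk⇔
  (λ i∈ → let pi , t = to (∈-select w _) i∈ ; b , gi = to (T-∧ {beyondᵇ d q i}) t in pi , to (beyondᵇ⇔ d q i) b , gi)
  (λ (pi , qi , gi) → from (∈-select w _) (pi , from T-∧ (from (beyondᵇ⇔ d q i) qi , gi)))

nearestIn-just : ∀ (w : Word k) d q (g : ℕ → Bool) {t} → nearestIn w d q g ≡ just t → NearestBy d w g q t
nearestIn-just w d q g {t} e = record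
  { beyond   = proj₁ (proj₂ t-spec)
  ; passes   = proj₂ (proj₂ t-spec)
  ; nearest  = λ pp qp gp → proj₂ extremal (from (∈-beyond w d q g) (pp , qp , gp))
  }
  where
  extremal = extreme-spec d (select-ascending w (λ i → beyondᵇ d q i ∧ g i)) e
  t-spec : Pos w t × q ≺[ d ] t × T (g t)
  t-spec = to (∈-beyond w d q g) (proj₁ extremal)

nearestIn-nothing : ∀ (w : Word k) d q (g : ℕ → Bool) {p} →
  nearestIn w d q g ≡ nothing → Pos w p → q ≺[ d ] p → ¬ T (g p)
nearestIn-nothing w d q g e pp qp gp = extreme-nothing d e (from (∈-beyond w d q g) (pp , qp , gp))

stepRel≡nearestIn : ∀ (w : Word k) d a q → stepRel w (d , a) q ≡ nearestIn w d q (isLetter w a)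
stepRel≡nearestIn w ▷ a q = refl
stepRel≡nearestIn w ◁ a q = refl

record Nearest (d : Dir) (w : Word k) (a : Fin k) (q t : ℕ) : Set where
  field
    beyond  : q ≺[ d ] t
    letter  : Letter w a t
    nearest : ∀ {p} → q ≺[ d ] p → Letter w a p → ¬ p ≺[ d ] t

step-just : ∀ (w : Word k) d a {q t} → stepRel w (d , a) q ≡ just t → Nearest d w a q t
step-just w d a {q} {t} e =
  let n = nearestIn-just w d q (isLetter w a) (trans (sym (stepRel≡nearestIn w d a q)) e)
  in record { beyond  = NearestBy.beyond n
            ; letter  = to (isLetter⇔ w a t) (NearestBy.passes n)
            ; nearest = λ {p} qp lp → NearestBy.nearest n (letter⇒Pos w p lp) qp (from (isLetter⇔ w a p) lp) }

step-defined : ∀ (w : Word k) d a {q p} → q ≺[ d ] p → Letter w a p → ∃[ t ] stepRel w (d , a) q ≡ just t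
step-defined w d a {q} {p} qp lp with stepRel w (d , a) q in e
... | just t  = t , refl
... | nothing = ⊥-elim (nearestIn-nothing w d q (isLetter w a) (trans (sym (stepRel≡nearestIn w d a q)) e)
                         (letter⇒Pos w p lp) qp (from (isLetter⇔ w a p) lp))

start : Word k → Dir → ℕ
start w ▷ = 0
start w ◁ = suc (length w)

start-≺ : ∀ (w : Word k) d {p} → Pos w p → start w d ≺[ d ] p
start-≺ w ▷ (1≤p , _) = 1≤p
start-≺ w ◁ (_ , p≤|w|) = s≤s p≤|w|

eval≡evalFrom : ∀ (w : Word k) d a ps → eval ((d , a) ∷ ps) w ≡ evalFrom w ((d , a) ∷ ps) (start w d)
eval≡evalFrom w ▷ a ps = refl
eval≡evalFrom w ◁ a ps = refl

bind≡just : ∀ {A B : Set} (m : Maybe A) {f : A → Maybe B} {t} →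
  (m >>= f) ≡ just t → ∃[ a ] m ≡ just a × f a ≡ just t
bind≡just (just a) e = a , refl , e

evalFrom-++ : ∀ (w : Word k) ps es q → evalFrom w (ps ++ es) q ≡ (evalFrom w ps q >>= evalFrom w es)
evalFrom-++ w [] es q = refl
evalFrom-++ w (e ∷ ps) es q with stepRel w e q
... | nothing = refl
... | just q' = evalFrom-++ w ps es q'

eval-++ : ∀ (w : Word k) e ps es → eval ((e ∷ ps) ++ es) w ≡ (eval (e ∷ ps) w >>= evalFrom w es)
eval-++ w (d , a) ps es = begin
  eval ((d , a) ∷ ps ++ es) w                                ≡⟨ eval≡evalFrom w d a (ps ++ es) ⟩
  evalFrom w ((d , a) ∷ ps ++ es) (start w d)                ≡⟨ evalFrom-++ w ((d , a) ∷ ps) es (start w d) ⟩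
  (evalFrom w ((d , a) ∷ ps) (start w d) >>= evalFrom w es)  ≡⟨ cong (_>>= evalFrom w es) (eval≡evalFrom w d a ps) ⟨
  (eval ((d , a) ∷ ps) w >>= evalFrom w es)                  ∎
  where open ≡-Reasoning

prefix-defined : ∀ (w : Word k) e ps es → Defined ((e ∷ ps) ++ es) w → Defined (e ∷ ps) w
prefix-defined w e ps es (t , ev) =
  let t' , ev' , _ = bind≡just (eval (e ∷ ps) w) (trans (sym (eval-++ w e ps es)) ev) in t' , ev'

lastLetter : BPos k → Ranker k → Fin k
lastLetter (_ , a) []       = a
lastLetter _       (e ∷ es) = lastLetter e es

evalFrom-letter : ∀ (w : Word k) e es {q t} → evalFrom w (e ∷ es) q ≡ just t → Letter w (lastLetter e es) t
evalFrom-letter w (d , a) [] {q} ev with stepRel w (d , a) q in st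
evalFrom-letter w (d , a) [] ev | just t with refl ← ev = Nearest.letter (step-just w d a st)
evalFrom-letter w e (e' ∷ es) {q} ev with stepRel w e q
... | just q' = evalFrom-letter w e' es ev

eval-letter : ∀ (w : Word k) e es {t} → eval (e ∷ es) w ≡ just t → Letter w (lastLetter e es) t
eval-letter w (d , a) es ev = evalFrom-letter w (d , a) es (trans (sym (eval≡evalFrom w d a es)) ev)

eval-Pos : ∀ (w : Word k) r {t} → eval r w ≡ just t → Pos w t
eval-Pos w (e ∷ es) {t} ev = letter⇒Pos w t (eval-letter w e es ev)

same-letter : ∀ (u v : Word k) r {s t} → eval r u ≡ just s → eval r v ≡ just t → letterAt u s ≡ letterAt v t
same-letter u v (e ∷ es) eu ev = trans (eval-letter u e es eu) (sym (eval-letter v e es ev))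

singleton-defined : ∀ (w : Word k) d a {p} → Pos w p → Letter w a p → Defined ((d , a) ∷ []) w
singleton-defined w d a pp lp =
  let t , st = step-defined w d a (start-≺ w d pp) lp
  in t , trans (eval≡evalFrom w d a []) (cong (_>>= evalFrom w []) st)

one-step : ∀ (w : Word k) {q} → 2 ≤ length w → Pos w q → ∃[ e ] ∃[ q' ] stepRel w e q ≡ just q'
one-step w {suc zero} 2≤|w| _ =
  let c , l₂ = Pos⇒letter w 2 (s≤s z≤n , 2≤|w|) in (▷ , c) , step-defined w ▷ c ≤-refl l₂
one-step w {suc (suc q)} 2≤|w| _ =
  let c , l₁ = Pos⇒letter w 1 (≤-refl , ≤-trans (s≤s z≤n) 2≤|w|)
  in (◁ , c) , step-defined w ◁ c (s≤s (s≤s z≤n)) l₁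

continue : ∀ (w : Word k) → 2 ≤ length w → ∀ m {q} → Pos w q →
  ∃[ es ] length es ≡ m × ∃[ t ] evalFrom w es q ≡ just t
continue w 2≤|w| zero {q} _ = [] , refl , q , refl
continue w 2≤|w| (suc m) pq with (d , a) , q' , st ← one-step w 2≤|w| pq =
  let es , len , t , ev = continue w 2≤|w| m (letter⇒Pos w q' (Nearest.letter (step-just w d a st)))
  in (d , a) ∷ es , cong suc len , t , trans (cong (_>>= evalFrom w es) st) ev

extend : ∀ (w : Word k) → 2 ≤ length w → ∀ e ps → Defined (e ∷ ps) w →
  ∀ m → ∃[ es ] length es ≡ m × Defined ((e ∷ ps) ++ es) w
extend w 2≤|w| e ps (t , ev) m =
  let es , len , t' , ev' = continue w 2≤|w| m (eval-Pos w (e ∷ ps) ev)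
  in es , len , t' , trans (eval-++ w e ps es) (trans (cong (_>>= evalFrom w es) ev) ev')

-- hence no ranker of length ≥ 2 is defined on it: its second step would have to move
short-word : ∀ (w : Word k) e₀ e₁ es → length w ≤ 1 → ¬ Defined (e₀ ∷ e₁ ∷ es) w
short-word w e₀ (d , a) es |w|≤1 def =
  let t , ev = prefix-defined w e₀ ((d , a) ∷ []) es def
      t₀ , e₀≡ , ev₁ = bind≡just (stepAbs w e₀) ev
      t₁ , st , _ = bind≡just (stepRel w (d , a) t₀) ev₁
      t₀≡1 = only-position w |w|≤1 (eval-Pos w (e₀ ∷ []) (cong (_>>= just) e₀≡))
      t₁≡1 = only-position w |w|≤1 (letter⇒Pos w t₁ (Nearest.letter (step-just w d a st)))
  in ≺-irrefl d (subst₂ (_≺[ d ]_) t₀≡1 t₁≡1 (Nearest.beyond (step-just w d a st)))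

ord-< : ∀ {i j} → i < j → ord i j ≡ lt
ord-< {i} {j} i<j with i <ᵇ j in e
... | true  = refl
... | false = ⊥-elim (subst T e (<⇒<ᵇ i<j))

ord-refl : ∀ i → ord i i ≡ eq
ord-refl i with i <ᵇ i in e | i ≡ᵇ i in e'
... | true  | _     = ⊥-elim (<-irrefl refl (<ᵇ⇒< i i (subst T (sym e) tt)))
... | false | true  = refl
... | false | false = ⊥-elim (subst T e' (≡⇒≡ᵇ i i refl))

ord-> : ∀ {i j} → j < i → ord i j ≡ gt
ord-> {i} {j} j<i with i <ᵇ j in e | i ≡ᵇ j in e'
... | true  | _     = ⊥-elim (<-asym j<i (<ᵇ⇒< i j (subst T (sym e) tt)))
... | false | true  = ⊥-elim (<-irrefl (sym (≡ᵇ⇒≡ i j (subst T (sym e') tt))) j<i)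
... | false | false = refl

ord-<⁻ : ∀ {i j} → ord i j ≡ lt → i < j
ord-<⁻ {i} {j} e with <-cmp i j
... | tri< i<j _ _ = i<j
... | tri≈ _ refl _ with () ← trans (sym e) (ord-refl i)
... | tri> _ _ j<i with () ← trans (sym e) (ord-> j<i)

ord-refl⁻ : ∀ {i j} → ord i j ≡ eq → i ≡ j
ord-refl⁻ {i} {j} e with <-cmp i j
... | tri< i<j _ _ with () ← trans (sym e) (ord-< i<j)
... | tri≈ _ i≡j _ = i≡j
... | tri> _ _ j<i with () ← trans (sym e) (ord-> j<i)

ord->⁻ : ∀ {i j} → ord i j ≡ gt → j < i
ord->⁻ {i} {j} e with <-cmp i j
... | tri< i<j _ _ with () ← trans (sym e) (ord-< i<j)
... | tri≈ _ refl _ with () ← trans (sym e) (ord-refl i)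
... | tri> _ _ j<i = j<i

toward : Dir → OrdT
toward ▷ = lt
toward ◁ = gt

ord-≺ : ∀ d {i j} → i ≺[ d ] j → ord i j ≡ toward d
ord-≺ ▷ = ord-<
ord-≺ ◁ = ord->

ord-≺⁻ : ∀ d {i j} → ord i j ≡ toward d → i ≺[ d ] j
ord-≺⁻ ▷ = ord-<⁻
ord-≺⁻ ◁ = ord->⁻

ord-≻ : ∀ d {i j} → j ≺[ d ] i → ord i j ≡ toward (opposite d)
ord-≻ ▷ = ord->
ord-≻ ◁ = ord-<

same-side : ∀ d {i j t} → (i ≺[ d ] t × j ≺[ d ] t) ⊎ (t ≺[ d ] i × t ≺[ d ] j) → ord i t ≡ ord j t
same-side d (inj₁ (it , jt)) = trans (ord-≺ d it) (sym (ord-≺ d jt))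
same-side d (inj₂ (ti , tj)) = trans (ord-≻ d ti) (sym (ord-≻ d tj))

ord-transfer≺ : ∀ d i j i' j' → ord i j ≡ ord i' j' → i ≺[ d ] j → i' ≺[ d ] j'
ord-transfer≺ d i j i' j' e ij = ord-≺⁻ d (trans (sym e) (ord-≺ d ij))

ord-cong : ∀ {i j i' j'} → (i < j ⇔ i' < j') → (j < i ⇔ j' < i') → ord i j ≡ ord i' j'
ord-cong {i} {j} {i'} {j'} lt⇔ gt⇔ with <-cmp i j
... | tri< i<j _ _ = trans (ord-< i<j) (sym (ord-< (to lt⇔ i<j)))
... | tri> _ _ j<i = trans (ord-> j<i) (sym (ord-> (to gt⇔ j<i)))
... | tri≈ _ refl _ with <-cmp i' j'
...   | tri< i'<j' _ _ = ⊥-elim (<-irrefl refl (from lt⇔ i'<j'))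
...   | tri> _ _ j'<i' = ⊥-elim (<-irrefl refl (from gt⇔ j'<i'))
...   | tri≈ _ refl _ = trans (ord-refl i) (sym (ord-refl i'))

ord-swap : ∀ i j i' j' → ord i j ≡ ord i' j' → ord j i ≡ ord j' i'
ord-swap i j i' j' e = ord-cong
  (mk⇔ (ord-transfer≺ ◁ i j i' j' e) (ord-transfer≺ ◁ i' j' i j (sym e)))
  (mk⇔ (ord-transfer≺ ▷ i j i' j' e) (ord-transfer≺ ▷ i' j' i j (sym e)))

ord-transfer≡ : ∀ i j i' j' → ord i j ≡ ord i' j' → i ≡ j → i' ≡ j'
ord-transfer≡ i _ i' j' e refl = ord-refl⁻ (trans (sym e) (ord-refl i))

ordM-just : ∀ i j i' {m : Maybe ℕ} → ordM (just i) (just j) ≡ ordM (just i') m →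
  ∃[ j' ] m ≡ just j' × ord i j ≡ ord i' j'
ordM-just i j i' {just j'} e = j' , refl , Data.Maybe.Properties.just-injective e

ordM-intro : ∀ {p q i j} {m m' : Maybe ℕ} → m ≡ just i → m' ≡ just j → ord p i ≡ ord q j →
  ordM (just p) m ≡ ordM (just q) m'
ordM-intro refl refl o = cong just o

Asg : Set
Asg = ℕ × ℕ

at : Var → Asg → ℕ
at z σ = val z (proj₁ σ) (proj₂ σ)

move : Var → ℕ → Asg → Asg
move z p σ = upd z p (proj₁ σ) (proj₂ σ)

satAt : Word k → Asg → FO2 k → Bool
satAt w σ φ = sat w (proj₁ σ) (proj₂ σ) φ

other : Var → Var
other x = y
other y = x

at-move : ∀ z p σ → at z (move z p σ) ≡ p
at-move x p σ = refl
at-move y p σ = refl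

move-at : ∀ z σ → move z (at z σ) σ ≡ σ
move-at x σ = refl
move-at y σ = refl

after-move : ∀ (P : Var → ℕ → ℕ → Set) z {p q σ τ} → P z p q → P (other z) (at (other z) σ) (at (other z) τ) →
  ∀ z' → P z' (at z' (move z p σ)) (at z' (move z q τ))
after-move P x moved _    x = moved
after-move P x _    kept y = kept
after-move P y _    kept x = kept
after-move P y moved _    y = moved

Atom : Word k → Asg → Word k → Asg → Set
Atom u σ v τ = (∀ z → letterAt u (at z σ) ≡ letterAt v (at z τ))
             × ord (proj₁ σ) (proj₂ σ) ≡ ord (proj₁ τ) (proj₂ τ)

atom-ord : ∀ {u v : Word k} {σ τ} → Atom u σ v τ → ∀ a b → ord (at a σ) (at b σ) ≡ ord (at a τ) (at b τ)
atom-ord {σ = σ} {τ} _ x x = trans (ord-refl (at x σ)) (sym (ord-refl (at x τ)))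
atom-ord {σ = σ} {τ} _ y y = trans (ord-refl (at y σ)) (sym (ord-refl (at y τ)))
atom-ord (_ , o) x y = o
atom-ord {σ = σ} {τ} (_ , o) y x = ord-swap (at x σ) (at y σ) (at x τ) (at y τ) o

isLetter-cong : ∀ (u v : Word k) c {i j} → letterAt u i ≡ letterAt v j → isLetter u c i ≡ isLetter v c j
isLetter-cong u v c {i} {j} e = T-ext (mk⇔
  (λ t → from (isLetter⇔ v c j) (trans (sym e) (to (isLetter⇔ u c i) t)))
  (λ t → from (isLetter⇔ u c i) (trans e (to (isLetter⇔ v c j) t))))

<ᵇ-cong : ∀ {i j i' j'} → ord i j ≡ ord i' j' → (i <ᵇ j) ≡ (i' <ᵇ j')
<ᵇ-cong {i} {j} {i'} {j'} e = T-ext (mk⇔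
  (λ t → <⇒<ᵇ (ord-transfer≺ ▷ i j i' j' e (<ᵇ⇒< i j t)))
  (λ t → <⇒<ᵇ (ord-transfer≺ ▷ i' j' i j (sym e) (<ᵇ⇒< i' j' t))))

≡ᵇ-cong : ∀ {i j i' j'} → ord i j ≡ ord i' j' → (i ≡ᵇ j) ≡ (i' ≡ᵇ j')
≡ᵇ-cong {i} {j} {i'} {j'} e = T-ext (mk⇔
  (λ t → ≡⇒≡ᵇ i' j' (ord-transfer≡ i j i' j' e (≡ᵇ⇒≡ i j t)))
  (λ t → ≡⇒≡ᵇ i j (ord-transfer≡ i' j' i j (sym e) (≡ᵇ⇒≡ i' j' t))))

atom-move : ∀ {u v : Word k} {σ τ} z p q → Atom u σ v τ → letterAt u p ≡ letterAt v q →
  ord p (at (other z) σ) ≡ ord q (at (other z) τ) → Atom u (move z p σ) v (move z q τ)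
atom-move {u = u} {v} z p q (letters , _) lpq o =
  after-move (λ _ i j → letterAt u i ≡ letterAt v j) z lpq (letters (other z)) , order z o
  where
  order : ∀ z {σ τ p q} → ord p (at (other z) σ) ≡ ord q (at (other z) τ) →
    ord (proj₁ (move z p σ)) (proj₂ (move z p σ)) ≡ ord (proj₁ (move z q τ)) (proj₂ (move z q τ))
  order x o = o
  order y {σ} {τ} {p} {q} o = ord-swap p (proj₁ σ) q (proj₁ τ) o

-- the Ehrenfeucht–Fraïssé game for FO²: duplicator survives n rounds, in each of which
-- spoiler moves one of the two pebbles x, y in one of the two words
Game : ℕ → Word k → Asg → Word k → Asg → Set
Game zero    u σ v τ = Atom u σ v τ
Game (suc n) u σ v τ = Atom u σ v τ
  × (∀ z → (∀ p → Pos u p → ∃[ q ] Pos v q × Game n u (move z p σ) v (move z q τ))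
         × (∀ q → Pos v q → ∃[ p ] Pos u p × Game n u (move z p σ) v (move z q τ)))

game-atom : ∀ n {u v : Word k} {σ τ} → Game n u σ v τ → Atom u σ v τ
game-atom zero    g = g
game-atom (suc n) g = proj₁ g

any-agree : ∀ (u v : Word k) (f g : ℕ → Bool) →
  (∀ p → Pos u p → ∃[ q ] Pos v q × f p ≡ g q) → (∀ q → Pos v q → ∃[ p ] Pos u p × f p ≡ g q) →
  any f (positions u) ≡ any g (positions v)
any-agree u v f g forth back = T-ext (mk⇔
  (λ t → let p , pp , fp = to (any-positions u f) t ; q , pq , e = forth p pp
         in from (any-positions v g) (q , pq , subst T e fp))
  (λ t → let q , pq , gq = to (any-positions v g) t ; p , pp , e = back q pq
         in from (any-positions u f) (p , pp , subst T (sym e) gq)))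

all-agree : ∀ (u v : Word k) (f g : ℕ → Bool) →
  (∀ p → Pos u p → ∃[ q ] Pos v q × f p ≡ g q) → (∀ q → Pos v q → ∃[ p ] Pos u p × f p ≡ g q) →
  all f (positions u) ≡ all g (positions v)
all-agree u v f g forth back = T-ext (mk⇔
  (λ t → from (all-positions v g) (λ q pq → let p , pp , e = back q pq in subst T e (to (all-positions u f) t p pp)))
  (λ t → from (all-positions u f) (λ p pp → let q , pq , e = forth p pp in subst T (sym e) (to (all-positions v g) t q pq))))

game⇒equiv : ∀ n {u v : Word k} {σ τ} → Game n u σ v τ → ∀ φ → qd φ ≤ n → satAt u σ φ ≡ satAt v τ φ
game⇒equiv n g tt _ = refl
game⇒equiv n g ff _ = refl
game⇒equiv n {u} {v} {σ} {τ} g (a <' b) _ =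
  <ᵇ-cong {at a σ} {at b σ} {at a τ} {at b τ} (atom-ord {u = u} {v} (game-atom n {u} {v} g) a b)
game⇒equiv n {u} {v} {σ} {τ} g (a =' b) _ =
  ≡ᵇ-cong {at a σ} {at b σ} {at a τ} {at b τ} (atom-ord {u = u} {v} (game-atom n {u} {v} g) a b)
game⇒equiv n {u} {v} g (Q c a) _ = isLetter-cong u v c (proj₁ (game-atom n g) a)
game⇒equiv n g (¬' φ) h = cong not (game⇒equiv n g φ h)
game⇒equiv n g (φ ∧' ψ) h =
  cong₂ _∧_ (game⇒equiv n g φ (m⊔n≤o⇒m≤o (qd φ) (qd ψ) h)) (game⇒equiv n g ψ (m⊔n≤o⇒n≤o (qd φ) (qd ψ) h))
game⇒equiv n g (φ ∨' ψ) h =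
  cong₂ _∨_ (game⇒equiv n g φ (m⊔n≤o⇒m≤o (qd φ) (qd ψ) h)) (game⇒equiv n g ψ (m⊔n≤o⇒n≤o (qd φ) (qd ψ) h))
game⇒equiv (suc n) {u} {v} (_ , moves) (∃' z φ) (s≤s h) = any-agree u v _ _
  (λ p pp → let q , pq , g = proj₁ (moves z) p pp in q , pq , game⇒equiv n g φ h)
  (λ q pq → let p , pp , g = proj₂ (moves z) q pq in p , pp , game⇒equiv n g φ h)
game⇒equiv (suc n) {u} {v} (_ , moves) (∀' z φ) (s≤s h) = all-agree u v _ _
  (λ p pp → let q , pq , g = proj₁ (moves z) p pp in q , pq , game⇒equiv n g φ h)
  (λ q pq → let p , pp , g = proj₂ (moves z) q pq in p , pp , game⇒equiv n g φ h)

boundaryPositions : ∀ k → List (BPos k)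
boundaryPositions k = cartesianProduct (▷ ∷ ◁ ∷ []) (allFin k)

∈-boundaryPositions : ∀ (e : BPos k) → e ∈ boundaryPositions k
∈-boundaryPositions (d , a) = ∈-cartesianProduct⁺ {xs = ▷ ∷ ◁ ∷ []} (∈-directions d) (∈-allFin a)
  where
  ∈-directions : ∀ d → d ∈ ▷ ∷ ◁ ∷ []
  ∈-directions ▷ = here refl
  ∈-directions ◁ = there (here refl)

rankersUpTo : ∀ k → ℕ → List (Ranker k)
rankersUpTo k zero    = [] ∷ []
rankersUpTo k (suc n) = [] ∷ cartesianProductWith _∷_ (boundaryPositions k) (rankersUpTo k n)

∈-rankersUpTo : ∀ n (r : Ranker k) → length r ≤ n → r ∈ rankersUpTo k n
∈-rankersUpTo zero    []      _         = here refl
∈-rankersUpTo (suc n) []      _         = here refl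
∈-rankersUpTo (suc n) (e ∷ r) (s≤s len) =
  there (∈-cartesianProductWith⁺ _∷_ (∈-boundaryPositions e) (∈-rankersUpTo n r len))

Value : ℕ → Word k → ℕ → Set
Value n w t = ∃[ r ] length r ≤ n × eval r w ≡ just t

-- being such a value is decidable: there are finitely many candidate rankers
value? : ∀ n (w : Word k) t → Dec (Value n w t)
value? {k} n w t with any? (λ r → (length r ≤? n) ×-dec (eval r w ≟ₘ just t)) (rankersUpTo k n)
  where _≟ₘ_ = Data.Maybe.Properties.≡-dec _≟_
... | yes some = yes (let r , _ , spec = find some in r , spec)
... | no none  = no (λ (r , spec) → none (lose (∈-rankersUpTo n r (proj₁ spec)) spec))

value-Pos : ∀ n (w : Word k) {t} → Value n w t → Pos w t
value-Pos n w (r , _ , ev) = eval-Pos w r ev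

record Cell (n : ℕ) (w : Word k) (d : Dir) (p : ℕ) : Set where
  field
    ranker     : Ranker k
    value      : ℕ
    short      : length ranker ≤ suc n
    evaluates  : eval ranker w ≡ just value
    letter     : letterAt w value ≡ letterAt w p
    not-before : ¬ value ≺[ d ] p
    separates  : ∀ {t} → Value n w t → p ≺[ d ] t → value ≺[ d ] t

-- the cell ranker steps back from the nearest value beyond p (or from the end of the word)
-- to the nearest occurrence of p's letter
cell : ∀ n (w : Word k) d p → Pos w p → Cell n w d p
cell n w d p pp with Pos⇒letter w p pp | nearestIn w d p (λ t → ⌊ value? n w t ⌋) in e
... | a , la | nothing =
  let t , st = step-defined w (opposite d) a (start-≺ w (opposite d) pp) la
      N = step-just w (opposite d) a st
  in record
    { ranker     = (opposite d , a) ∷ []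
    ; value      = t
    ; short      = s≤s z≤n
    ; evaluates  = trans (eval≡evalFrom w (opposite d) a []) (cong (_>>= evalFrom w []) st)
    ; letter     = trans (Nearest.letter N) (sym la)
    ; not-before = λ t≺p → Nearest.nearest N (start-≺ w (opposite d) pp) la (from (≺-opposite d) t≺p)
    ; separates  = λ {t'} val p≺t' →
        ⊥-elim (nearestIn-nothing w d p _ e (value-Pos n w val) p≺t' (fromWitness val))
    }
... | a , la | just t with (e₀ ∷ ps) , len , ev ← toWitness (NearestBy.passes (nearestIn-just w d p _ e)) =
  let N = nearestIn-just w d p _ e
      cw , st = step-defined w (opposite d) a (from (≺-opposite d) (NearestBy.beyond N)) la
      M = step-just w (opposite d) a st
      cw≺t = to (≺-opposite d) (Nearest.beyond M)
  in record
    { ranker     = (e₀ ∷ ps) ++ (opposite d , a) ∷ []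
    ; value      = cw
    ; short      = subst (_≤ suc n) (sym (trans (length-++ (e₀ ∷ ps)) (+-comm (length (e₀ ∷ ps)) 1))) (s≤s len)
    ; evaluates  = trans (eval-++ w e₀ ps ((opposite d , a) ∷ []))
                         (trans (cong (_>>= evalFrom w ((opposite d , a) ∷ [])) ev) (cong (_>>= evalFrom w []) st))
    ; letter     = trans (Nearest.letter M) (sym la)
    ; not-before = λ cw≺p → Nearest.nearest M (from (≺-opposite d) (NearestBy.beyond N)) la (from (≺-opposite d) cw≺p)
    ; separates  = λ val p≺t' →
        ≺-≼-trans d cw≺t (NearestBy.nearest N (value-Pos n w val) p≺t' (fromWitness val))
    }

cell-ord : ∀ {n} {w : Word k} {d p t} (c : Cell n w d p) → Value n w t → t ≢ p → ord p t ≡ ord (Cell.value c) t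
cell-ord {d = d} {p} {t} c val t≢p with ≺-connex d {p} {t} (t≢p ∘ sym)
... | inj₁ p≺t = same-side d (inj₁ (p≺t , Cell.separates c val p≺t))
... | inj₂ t≺p = same-side d (inj₂ (t≺p , ≺-≼-trans d t≺p (Cell.not-before c)))

InR*-mono : ∀ {m m'} (w : Word k) r → m ≤ m' → InR* m w r → InR* m' w r
InR*-mono w r m≤m' ((1≤ , ≤m) , def) = (1≤ , ≤-trans ≤m m≤m') , def

value⇒InR* : ∀ {n} (w : Word k) r {t} → length r ≤ n → eval r w ≡ just t → InR* n w r
value⇒InR* w (_ ∷ _) len ev = (s≤s z≤n , len) , _ , ev

-- condition (i) of the theorem, with (c) stated as agreement on atoms, for pebble assignments σ and τ
record Invariant (n : ℕ) (u : Word k) (σ : Asg) (v : Word k) (τ : Asg) : Set where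
  field
    pebbles-u  : ∀ z → Pos u (at z σ)
    pebbles-v  : ∀ z → Pos v (at z τ)
    rankers    : ∀ r → InR n u r ⇔ InR n v r
    ranker-ord : ∀ r r' → InR* n u r → InR* (n ∸ 1) u r' →
                 ordM (eval r u) (eval r' u) ≡ ordM (eval r v) (eval r' v)
    atoms      : Atom u σ v τ
    pebble-ord : ∀ z r → InR* n u r → ordM (just (at z σ)) (eval r u) ≡ ordM (just (at z τ)) (eval r v)

module _ {n} {u v : Word k} {σ τ} (I : Invariant n u σ v τ) where
  open Invariant I

  pebble-values : ∀ z r {tu} → length r ≤ n → eval r u ≡ just tu →
    ∃[ tv ] eval r v ≡ just tv × ord (at z σ) tu ≡ ord (at z τ) tv
  pebble-values z r {tu} len eu =
    ordM-just (at z σ) tu (at z τ)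
      (trans (cong (ordM (just (at z σ))) (sym eu)) (pebble-ord z r (value⇒InR* u r len eu)))

  -- conversely, rankers of length ≤ n defined on v are defined on u: by (a) if v can extend
  -- them to length n, and by the letter of the pebble x if v has a single position
  lift : ∀ r → length r ≤ n → Defined r v → Defined r u
  lift r len def with 2 ≤? length v
  lift (e ∷ ps) len def | yes 2≤|v| =
    let es , les , def' = extend v 2≤|v| e ps def (n ∸ length (e ∷ ps))
        len' = trans (length-++ (e ∷ ps)) (trans (cong (length (e ∷ ps) +_) les) (m+[n∸m]≡n len))
    in prefix-defined u e ps es (proj₂ (from (rankers ((e ∷ ps) ++ es)) (len' , def')))
  lift ((d , a) ∷ []) len (t , ev) | no |v|≱2 =
    let |v|≤1 = ≤-pred (≰⇒> |v|≱2)
        t≡j = trans (only-position v |v|≤1 (eval-Pos v ((d , a) ∷ []) ev)) (sym (only-position v |v|≤1 (pebbles-v x)))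
    in singleton-defined u d a (pebbles-u x)
         (trans (proj₁ atoms x) (trans (cong (letterAt v) (sym t≡j)) (eval-letter v (d , a) [] ev)))
  lift (e₀ ∷ e₁ ∷ ps) len def | no |v|≱2 = ⊥-elim (short-word v e₀ e₁ ps (≤-pred (≰⇒> |v|≱2)) def)

  lift* : ∀ {m} r → m ≤ n → InR* m v r → InR* m u r
  lift* r m≤n (len , def) = len , lift r (≤-trans (proj₂ len) m≤n) def

  invariant-sym : Invariant n v τ u σ
  invariant-sym = record
    { pebbles-u  = pebbles-v
    ; pebbles-v  = pebbles-u
    ; rankers    = λ r → mk⇔ (from (rankers r)) (to (rankers r))
    ; ranker-ord = λ r r' h h' → sym (ranker-ord r r' (lift* r ≤-refl h) (lift* r' (m∸n≤m n 1) h'))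
    ; atoms      = (λ z → sym (proj₁ atoms z)) , sym (proj₂ atoms)
    ; pebble-ord = λ z r h → sym (pebble-ord z r (lift* r ≤-refl h))
    }

module _ {n} {u v : Word k} {σ τ} (I : Invariant (suc n) u σ v τ) where
  open Invariant I

  rankers-down : ∀ r → InR n u r ⇔ InR n v r
  rankers-down r = mk⇔
    (λ (len , _ , eu) → len , let tv , ev , _ = pebble-values I x r (≤-trans (≤-reflexive len) (n≤1+n n)) eu in tv , ev)
    (λ (len , def) → len , lift I r (≤-trans (≤-reflexive len) (n≤1+n n)) def)

  restrict : ∀ z {p q} → Pos u p → Pos v q → letterAt u p ≡ letterAt v q →
    ord p (at (other z) σ) ≡ ord q (at (other z) τ) →
    (∀ r → InR* n u r → ordM (just p) (eval r u) ≡ ordM (just q) (eval r v)) →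
    Invariant n u (move z p σ) v (move z q τ)
  restrict z {p} {q} pp pq lpq o moved = record
    { pebbles-u  = after-move (λ _ i _ → Pos u i) z {p} {q} {σ} {τ} pp (pebbles-u (other z))
    ; pebbles-v  = after-move (λ _ _ j → Pos v j) z {p} {q} {σ} {τ} pq (pebbles-v (other z))
    ; rankers    = rankers-down
    ; ranker-ord = λ r r' h h' → ranker-ord r r' (InR*-mono u r (n≤1+n n) h) (InR*-mono u r' (m∸n≤m n 1) h')
    ; atoms      = atom-move {u = u} {v} z p q atoms lpq o
    ; pebble-ord = after-move (λ _ i j → ∀ r → InR* n u r → ordM (just i) (eval r u) ≡ ordM (just j) (eval r v))
                     z moved (λ r h → pebble-ord (other z) r (InR*-mono u r (n≤1+n n) h))
    }

  -- p is the value r(u) of a ranker of length ≤ n: answer with r(v)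
  forth-value : ∀ z r {p} → Pos u p → length r ≤ n → eval r u ≡ just p →
    ∃[ q ] Pos v q × Invariant n u (move z p σ) v (move z q τ)
  forth-value z r {p} pp len eu = q , q-pos , restrict z pp q-pos
    (same-letter u v r eu ev)
    (ord-swap (at (other z) σ) p (at (other z) τ) q (proj₂ (proj₂ q-spec)))
    moved
    where
    len' = ≤-trans len (n≤1+n n)
    q-spec = pebble-values I (other z) r len' eu
    q = proj₁ q-spec
    ev = proj₁ (proj₂ q-spec)
    q-pos = eval-Pos v r ev
    moved : ∀ r' → InR* n u r' → ordM (just p) (eval r' u) ≡ ordM (just q) (eval r' v)
    moved r' h' = begin
      ordM (just p) (eval r' u)   ≡⟨ cong (λ m → ordM m (eval r' u)) eu ⟨
      ordM (eval r u) (eval r' u) ≡⟨ ranker-ord r r' (value⇒InR* u r len' eu) h' ⟩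
      ordM (eval r v) (eval r' v) ≡⟨ cong (λ m → ordM m (eval r' v)) ev ⟩
      ordM (just q) (eval r' v)   ∎
      where open ≡-Reasoning

  -- p is not a value of R*_n(u) and lies beyond the other pebble in direction d: answer with the cell ranker
  forth-cell : ∀ z d {p} → Pos u p → at (other z) σ ≺[ d ] p → ¬ Value n u p →
    ∃[ q ] Pos v q × Invariant n u (move z p σ) v (move z q τ)
  forth-cell z d {p} pp s≺p p∉V = q , q-pos , restrict z pp q-pos
    (trans (sym letter) (same-letter u v ranker evaluates ev))
    (trans (ord-≻ d s≺p) (sym (ord-≻ d t≺q)))
    moved
    where
    open Cell (cell n u d p pp)
    q-spec = pebble-values I (other z) ranker short evaluates
    q = proj₁ q-spec
    ev = proj₁ (proj₂ q-spec)
    q-pos = eval-Pos v ranker ev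
    t≺q : at (other z) τ ≺[ d ] q
    t≺q = ord-transfer≺ d (at (other z) σ) value (at (other z) τ) q (proj₂ (proj₂ q-spec)) (≺-≼-trans d s≺p not-before)
    moved : ∀ r → InR* n u r → ordM (just p) (eval r u) ≡ ordM (just q) (eval r v)
    moved r h@((_ , len) , t , eu) =
      let same = trans (cong₂ ordM (sym evaluates) (sym eu)) (ranker-ord ranker r (value⇒InR* u ranker short evaluates) h)
          t' , ev' , o = ordM-just value t q (trans same (cong (λ m → ordM m (eval r v)) ev))
      in ordM-intro eu ev' (trans (cell-ord (cell n u d p pp) (r , len , eu) (λ { refl → p∉V (r , len , eu) })) o)

  forth : ∀ z p → Pos u p → ∃[ q ] Pos v q × Invariant n u (move z p σ) v (move z q τ)
  forth z p pp with p ≟ at (other z) σ | value? n u p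
  ... | yes refl | _ = at (other z) τ , pebbles-v (other z) ,
    restrict z pp (pebbles-v (other z)) (proj₁ atoms (other z)) (trans (ord-refl p) (sym (ord-refl (at (other z) τ))))
      (λ r h → pebble-ord (other z) r (InR*-mono u r (n≤1+n n) h))
  ... | no _     | yes (r , len , eu) = forth-value z r pp len eu
  ... | no p≢s   | no p∉V = let d , s≺p = direction (p≢s ∘ sym) in forth-cell z d pp s≺p p∉V

-- condition (i) is a winning position for duplicator: spoiler's moves in v are answered
-- by the forth strategy applied to the symmetric condition
invariant⇒game : ∀ n {u v : Word k} {σ τ} → Invariant n u σ v τ → Game n u σ v τ
invariant⇒game zero    I = Invariant.atoms I
invariant⇒game (suc n) I = Invariant.atoms I , λ z →
    (λ p pp → let q , pq , I' = forth I z p pp in q , pq , invariant⇒game n I')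
  , (λ q pq → let p , pp , I' = forth (invariant-sym I) z q pq in p , pp , invariant⇒game n (invariant-sym I'))

Family : ℕ → Set
Family k = Dir → Var → FO2 k

record Describes (w : Word k) (v : Var) (σ : Asg) (H : Dir → FO2 k) (Z : ℕ) : Set where
  constructor mkDescribes
  field describe : ∀ d p → Pos w p → T (satAt w (move v p σ) (H d)) ⇔ Z ≺[ d ] p
open Describes

record Defines (w : Word k) (F : Family k) (Z : ℕ) : Set where
  constructor mkDefines
  field define : ∀ v σ → Describes w v σ (λ d → F d v) Z
open Defines

∃-letter : Var → Fin k → FO2 k → FO2 k → FO2 k
∃-letter v a A B = ∃' v (A ∧' (Q a v ∧' B))

∃-letter⇔ : ∀ (w : Word k) σ v a A B → T (satAt w σ (∃-letter v a A B)) ⇔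
  (∃[ p ] Pos w p × T (satAt w (move v p σ) A) × Letter w a p × T (satAt w (move v p σ) B))
∃-letter⇔ w σ v a A B = mk⇔
  (λ t → let p , pp , h = to (any-positions w _) t
             hA , hQB = to (T-∧ {satAt w (move v p σ) A}) h
             hQ , hB = to (T-∧ {satAt w (move v p σ) (Q a v)}) hQB
         in p , pp , hA , subst (Letter w a) (at-move v p σ) (to (isLetter⇔ w a _) hQ) , hB)
  (λ (p , pp , hA , lp , hB) → from (any-positions w _)
    (p , pp , from T-∧ (hA , from T-∧ (from (isLetter⇔ w a _) (subst (Letter w a) (sym (at-move v p σ)) lp) , hB))))

-- t ≺[ d ] Z for the value t of (d , a) at q: some a-position beyond q lies before Z
ahead : Dir → Fin k → Family k → (Dir → FO2 k) → Var → FO2 k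
ahead d a F H v = ∃-letter v a (H (opposite d)) (F d v)

-- Z ≺[ d ] t: no a-position beyond q lies at or before Z
behind : Dir → Fin k → Family k → (Dir → FO2 k) → Var → FO2 k
behind d a F H v = ¬' ∃-letter v a (¬' H d) (F d v)

module _ {w : Word k} {F : Family k} {d a q t} (F-q : Defines w F q) (st : stepRel w (d , a) q ≡ just t) where
  private
    N = step-just w d a st

  ahead-sem : ∀ {v σ H Z} → Describes w v σ H Z → T (satAt w σ (ahead d a F H v)) ⇔ t ≺[ d ] Z
  ahead-sem {v} {σ} {H} {Z} (mkDescribes H-Z) = mk⇔
    (λ h → let p , pp , p≺Z , lp , q≺p = to (∃-letter⇔ w σ v a (H (opposite d)) (F d v)) h
           in ≼-≺-trans d (Nearest.nearest N (to (describe (define F-q v σ) d p pp) q≺p) lp)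
                          (to (≺-opposite d) (to (H-Z (opposite d) p pp) p≺Z)))
    (λ t≺Z → let pt = letter⇒Pos w t (Nearest.letter N)
             in from (∃-letter⇔ w σ v a (H (opposite d)) (F d v))
                  (t , pt , from (H-Z (opposite d) t pt) (from (≺-opposite d) t≺Z) , Nearest.letter N
                     , from (describe (define F-q v σ) d t pt) (Nearest.beyond N)))

  behind-sem : ∀ {v σ H Z} → Describes w v σ H Z → T (satAt w σ (behind d a F H v)) ⇔ Z ≺[ d ] t
  behind-sem {v} {σ} {H} {Z} (mkDescribes H-Z) = mk⇔
    (λ h → case-≺ (to T-not⇔ h))
    (λ Z≺t → from T-not⇔ (λ h →
      let p , pp , ¬Z≺p , lp , q≺p = to (∃-letter⇔ w σ v a (¬' H d) (F d v)) h
      in to T-not⇔ ¬Z≺p (from (H-Z d p pp)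
           (≺-≼-trans d Z≺t (Nearest.nearest N (to (describe (define F-q v σ) d p pp) q≺p) lp)))))
    where
    pt = letter⇒Pos w t (Nearest.letter N)
    case-≺ : ¬ T (satAt w σ (∃-letter v a (¬' H d) (F d v))) → Z ≺[ d ] t
    case-≺ none with ≺? d Z t
    ... | yes Z≺t = Z≺t
    ... | no ¬Z≺t = ⊥-elim (none (from (∃-letter⇔ w σ v a (¬' H d) (F d v))
          (t , pt , from T-not⇔ (¬Z≺t ∘ to (H-Z d t pt)) , Nearest.letter N
             , from (describe (define F-q v σ) d t pt) (Nearest.beyond N))))

stepTo : BPos k → Family k → (Dir → FO2 k) → Var → Dir → FO2 k
stepTo (▷ , a) F H v ▷ = ahead  ▷ a F H v
stepTo (▷ , a) F H v ◁ = behind ▷ a F H v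
stepTo (◁ , a) F H v ▷ = behind ◁ a F H v
stepTo (◁ , a) F H v ◁ = ahead  ◁ a F H v

stepTo-sem : ∀ {w : Word k} {F} e {q t} → Defines w F q → stepRel w e q ≡ just t →
  ∀ {v σ H Z} → Describes w v σ H Z → ∀ d' → T (satAt w σ (stepTo e F H v d')) ⇔ t ≺[ d' ] Z
stepTo-sem (▷ , a) F-q st H-Z ▷ = ahead-sem  F-q st H-Z
stepTo-sem (▷ , a) F-q st H-Z ◁ = behind-sem F-q st H-Z
stepTo-sem (◁ , a) F-q st H-Z ▷ = behind-sem F-q st H-Z
stepTo-sem (◁ , a) F-q st H-Z ◁ = ahead-sem  F-q st H-Z

pebbleH : Var → Dir → FO2 k
pebbleH z ▷ = z <' other z
pebbleH z ◁ = other z <' z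

pebble-describes : ∀ (w : Word k) z p σ → Describes w (other z) (move z p σ) (pebbleH z) p
pebble-describes w z p σ = mkDescribes (compare z)
  where
  compare : ∀ z d p' → Pos w p' → T (satAt w (move (other z) p' (move z p σ)) (pebbleH z d)) ⇔ p ≺[ d ] p'
  compare x ▷ p' _ = mk⇔ (<ᵇ⇒< p p') <⇒<ᵇ
  compare x ◁ p' _ = mk⇔ (<ᵇ⇒< p' p) <⇒<ᵇ
  compare y ▷ p' _ = mk⇔ (<ᵇ⇒< p p') <⇒<ᵇ
  compare y ◁ p' _ = mk⇔ (<ᵇ⇒< p' p) <⇒<ᵇ

-- comparing with the free variable itself yields a defining family for the next position
stepF : BPos k → Family k → Family k
stepF e F d' z = stepTo e F (pebbleH z) (other z) d'

step-defines : ∀ {w : Word k} {F} e {q t} → Defines w F q → stepRel w e q ≡ just t → Defines w (stepF e F) t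
step-defines {w = w} e F-q st = mkDefines λ v σ → mkDescribes λ d' p _ → stepTo-sem e F-q st (pebble-describes w v p σ) d'

startF : Dir → Family k
startF ▷ ▷ _ = tt
startF ▷ ◁ _ = ff
startF ◁ ▷ _ = ff
startF ◁ ◁ _ = tt

start-defines : ∀ (w : Word k) d → Defines w (startF d) (start w d)
start-defines w d = mkDefines λ v σ → mkDescribes (compare d {v} {σ})
  where
  compare : ∀ d {v σ} d' p → Pos w p → T (satAt w (move v p σ) (startF d d' v)) ⇔ start w d ≺[ d' ] p
  compare ▷ ▷ p (1≤p , _)   = mk⇔ (λ _ → 1≤p) (λ _ → tt)
  compare ▷ ◁ p _           = mk⇔ (λ ()) (λ ())
  compare ◁ ▷ p (_ , p≤|w|) = mk⇔ (λ ()) (λ |w|<p → <⇒≱ |w|<p (≤-trans p≤|w| (n≤1+n _)))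
  compare ◁ ◁ p (_ , p≤|w|) = mk⇔ (λ _ → s≤s p≤|w|) (λ _ → tt)

towardF : BPos k → Ranker k → Family k → (Dir → FO2 k) → Var → Dir → FO2 k
towardF e []        F = stepTo e F
towardF e (e' ∷ es) F = towardF e' es (stepF e F)

towardF-sem : ∀ {w : Word k} e es {F q t} → Defines w F q → evalFrom w (e ∷ es) q ≡ just t →
  ∀ {v σ H Z} → Describes w v σ H Z → ∀ d' → T (satAt w σ (towardF e es F H v d')) ⇔ t ≺[ d' ] Z
towardF-sem {w = w} e [] {q = q} F-q ev with stepRel w e q in st
towardF-sem e [] F-q refl | just t = stepTo-sem e F-q st
towardF-sem {w = w} e (e' ∷ es) {q = q} F-q ev with stepRel w e q in st
... | just q' = towardF-sem e' es (step-defines e F-q st) ev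

rankerToward : Ranker k → (Dir → FO2 k) → Var → Dir → FO2 k
rankerToward []               H v d' = ff
rankerToward ((d , a) ∷ ps) H v d' = towardF (d , a) ps (startF d) H v d'

rankerToward-sem : ∀ (w : Word k) r {t} → eval r w ≡ just t →
  ∀ {v σ H Z} → Describes w v σ H Z → ∀ d' → T (satAt w σ (rankerToward r H v d')) ⇔ t ≺[ d' ] Z
rankerToward-sem w ((d , a) ∷ ps) ev =
  towardF-sem (d , a) ps (start-defines w d) (trans (sym (eval≡evalFrom w d a ps)) ev)

rankerF : Ranker k → Family k
rankerF r d' z = rankerToward r (pebbleH z) (other z) d'

ranker-defines : ∀ (w : Word k) r {t} → eval r w ≡ just t → Defines w (rankerF r) t
ranker-defines w r ev = mkDefines λ v σ → mkDescribes λ d' p _ → rankerToward-sem w r ev (pebble-describes w v p σ) d'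

definedFrom : Ranker k → Family k → FO2 k
definedFrom []             F = tt
definedFrom ((d , a) ∷ es) F = ∃-letter x a tt (F d x) ∧' definedFrom es (stepF (d , a) F)

definedFrom-sem : ∀ (w : Word k) {F q} → Defines w F q → ∀ es σ →
  T (satAt w σ (definedFrom es F)) ⇔ (∃[ t ] evalFrom w es q ≡ just t)
definedFrom-sem w {q = q} F-q [] σ = mk⇔ (λ _ → q , refl) (λ _ → tt)
definedFrom-sem w {F} {q} F-q ((d , a) ∷ es) σ = mk⇔
  (λ h → let h₁ , h₂ = to (T-∧ {satAt w σ (∃-letter x a tt (F d x))}) h
             q' , st = to step⇔ h₁
             t , ev = to (definedFrom-sem w (step-defines (d , a) F-q st) es σ) h₂
         in t , trans (cong (_>>= evalFrom w es) st) ev)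
  (λ (t , ev) → let q' , st , ev' = bind≡just (stepRel w (d , a) q) ev
                in from T-∧ (from step⇔ (q' , st) , from (definedFrom-sem w (step-defines (d , a) F-q st) es σ) (t , ev')))
  where
  step⇔ : T (satAt w σ (∃-letter x a tt (F d x))) ⇔ (∃[ q' ] stepRel w (d , a) q ≡ just q')
  step⇔ = mk⇔
    (λ h → let p , pp , _ , lp , q≺p = to (∃-letter⇔ w σ x a tt (F d x)) h
           in step-defined w d a (to (describe (define F-q x σ) d p pp) q≺p) lp)
    (λ (q' , st) → let N = step-just w d a st ; pq' = letter⇒Pos w q' (Nearest.letter N)
                   in from (∃-letter⇔ w σ x a tt (F d x))
                        (q' , pq' , tt , Nearest.letter N , from (describe (define F-q x σ) d q' pq') (Nearest.beyond N)))

definedR : Ranker k → FO2 k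
definedR []               = ff
definedR ((d , a) ∷ ps) = definedFrom ((d , a) ∷ ps) (startF d)

definedR-sem : ∀ (w : Word k) r σ → T (satAt w σ (definedR r)) ⇔ Defined r w
definedR-sem w [] σ = mk⇔ (λ ()) (λ { (_ , ()) })
definedR-sem w ((d , a) ∷ ps) σ = mk⇔
  (λ h → let t , ev = to (definedFrom-sem w (start-defines w d) ((d , a) ∷ ps) σ) h
         in t , trans (eval≡evalFrom w d a ps) ev)
  (λ (t , ev) → from (definedFrom-sem w (start-defines w d) ((d , a) ∷ ps) σ) (t , trans (sym (eval≡evalFrom w d a ps)) ev))

Depth≤ : Family k → ℕ → Set
Depth≤ F m = ∀ d z → qd (F d z) ≤ m

∃-letter-depth : ∀ {m} v (a : Fin k) A B → qd A ≤ m → qd B ≤ m → qd (∃-letter v a A B) ≤ suc m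
∃-letter-depth v a A B A≤ B≤ = s≤s (⊔-lub A≤ (⊔-lub z≤n B≤))

stepTo-depth : ∀ {m} {F : Family k} {H} → Depth≤ F m → (∀ d → qd (H d) ≤ m) →
  ∀ e v d' → qd (stepTo e F H v d') ≤ suc m
stepTo-depth {F = F} {H} F≤ H≤ (▷ , a) v ▷ = ∃-letter-depth v a (H ◁) (F ▷ v) (H≤ ◁) (F≤ ▷ v)
stepTo-depth {F = F} {H} F≤ H≤ (▷ , a) v ◁ = ∃-letter-depth v a (¬' H ▷) (F ▷ v) (H≤ ▷) (F≤ ▷ v)
stepTo-depth {F = F} {H} F≤ H≤ (◁ , a) v ▷ = ∃-letter-depth v a (¬' H ◁) (F ◁ v) (H≤ ◁) (F≤ ◁ v)
stepTo-depth {F = F} {H} F≤ H≤ (◁ , a) v ◁ = ∃-letter-depth v a (H ▷) (F ◁ v) (H≤ ▷) (F≤ ◁ v)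

step-depth : ∀ {m} {F : Family k} → Depth≤ F m → ∀ e → Depth≤ (stepF e F) (suc m)
step-depth F≤ e d' z = stepTo-depth F≤ (λ { ▷ → z≤n ; ◁ → z≤n }) e (other z) d'

start-depth : ∀ d → Depth≤ (startF {k} d) 0
start-depth ▷ ▷ _ = z≤n
start-depth ▷ ◁ _ = z≤n
start-depth ◁ ▷ _ = z≤n
start-depth ◁ ◁ _ = z≤n

towardF-depth : ∀ {m M} {F : Family k} {H} e es → Depth≤ F m → m + length es ≤ M → (∀ d → qd (H d) ≤ M) →
  ∀ v d' → qd (towardF e es F H v d') ≤ suc M
towardF-depth {m = m} e [] F≤ m≤M H≤ = stepTo-depth (λ d z → ≤-trans (F≤ d z) (≤-trans (m≤m+n m 0) m≤M)) H≤ e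
towardF-depth {m = m} e (e' ∷ es) F≤ m≤M H≤ =
  towardF-depth e' es (step-depth F≤ e) (≤-trans (≤-reflexive (sym (+-suc m (length es)))) m≤M) H≤

rankerToward-depth : ∀ {M} r {H : Dir → FO2 k} → length r ≤ suc M → (∀ d → qd (H d) ≤ M) →
  ∀ v d' → qd (rankerToward r H v d') ≤ suc M
rankerToward-depth [] _ _ _ _ = z≤n
rankerToward-depth ((d , a) ∷ ps) (s≤s len) H≤ = towardF-depth (d , a) ps (start-depth d) len H≤

ranker-depth : ∀ (r : Ranker k) → Depth≤ (rankerF r) (length r)
ranker-depth [] _ _ = z≤n
ranker-depth (e ∷ ps) d' z = rankerToward-depth (e ∷ ps) ≤-refl (λ { ▷ → z≤n ; ◁ → z≤n }) (other z) d'

definedFrom-depth : ∀ {m M} {F : Family k} es → Depth≤ F m → m + length es ≤ M → qd (definedFrom es F) ≤ M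
definedFrom-depth [] F≤ _ = z≤n
definedFrom-depth {m = m} {F = F} ((d , a) ∷ es) F≤ m+l≤M = ⊔-lub
  (≤-trans (∃-letter-depth x a tt (F d x) z≤n (F≤ d x)) (≤-trans (s≤s (m≤m+n m (length es))) suc-m+l≤M))
  (definedFrom-depth es (step-depth F≤ (d , a)) suc-m+l≤M)
  where
  suc-m+l≤M = ≤-trans (≤-reflexive (sym (+-suc m (length es)))) m+l≤M

definedR-depth : ∀ (r : Ranker k) → qd (definedR r) ≤ length r
definedR-depth [] = z≤n
definedR-depth ((d , a) ∷ ps) = definedFrom-depth ((d , a) ∷ ps) (start-depth d) ≤-refl

module _ {n} {u v : Word k} {σ τ} (fo : ∀ φ → qd φ ≤ n → satAt u σ φ ≡ satAt v τ φ) where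

  transfer : ∀ φ → qd φ ≤ n → T (satAt u σ φ) ⇔ T (satAt v τ φ)
  transfer φ h = mk⇔ (subst T (fo φ h)) (subst T (sym (fo φ h)))

  compare-transfer : ∀ (C : Dir → FO2 k) {i j i' j'} → (∀ d → qd (C d) ≤ n) →
    (∀ d → T (satAt u σ (C d)) ⇔ i ≺[ d ] j) → (∀ d → T (satAt v τ (C d)) ⇔ i' ≺[ d ] j') → ord i j ≡ ord i' j'
  compare-transfer C C≤ C-u C-v = ord-cong (along ▷) (along ◁)
    where
    along : ∀ d → _ ⇔ _
    along d = mk⇔ (to (C-v d) ∘ to (transfer (C d) (C≤ d)) ∘ from (C-u d))
                  (to (C-u d) ∘ from (transfer (C d) (C≤ d)) ∘ from (C-v d))

  defined-transfer : ∀ r → length r ≤ n → Defined r u ⇔ Defined r v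
  defined-transfer r len = mk⇔
    (to (definedR-sem v r τ) ∘ to (transfer (definedR r) depth) ∘ from (definedR-sem u r σ))
    (to (definedR-sem u r σ) ∘ from (transfer (definedR r) depth) ∘ from (definedR-sem v r τ))
    where depth = ≤-trans (definedR-depth r) len

  -- (a): definedness of a ranker is expressed with depth its length
  equiv-rankers : ∀ r → InR n u r ⇔ InR n v r
  equiv-rankers r = mk⇔ (λ (len , def) → len , to (defined-transfer r (≤-reflexive len)) def)
                        (λ (len , def) → len , from (defined-transfer r (≤-reflexive len)) def)

  -- (b): the last step of r, compared with the value of r', is expressed with depth n
  equiv-ranker-ord : ∀ r r' → InR* n u r → InR* (n ∸ 1) u r' →
    ordM (eval r u) (eval r' u) ≡ ordM (eval r v) (eval r' v)
  equiv-ranker-ord r r' ((1≤|r| , |r|≤n) , t , eu) ((_ , |r'|≤n-1) , Z , eu') =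
    let t' , ev = to (defined-transfer r |r|≤n) (t , eu)
        Z' , ev' = to (defined-transfer r' (≤-trans |r'|≤n-1 (m∸n≤m n 1))) (Z , eu')
        n≡ = m+[n∸m]≡n {1} {n} (≤-trans 1≤|r| |r|≤n)
        C = λ d → rankerToward r (λ d' → rankerF r' d' x) x d
        C≤ = λ d → subst (qd (C d) ≤_) n≡ (rankerToward-depth r (subst (length r ≤_) (sym n≡) |r|≤n)
                                            (λ d' → ≤-trans (ranker-depth r' d' x) |r'|≤n-1) x d)
        o = compare-transfer C C≤
              (rankerToward-sem u r eu (define (ranker-defines u r' eu') x σ))
              (rankerToward-sem v r ev (define (ranker-defines v r' ev') x τ))
    in trans (cong₂ ordM eu eu') (trans (cong just o) (sym (cong₂ ordM ev ev')))

  module _ (pebbles-u : ∀ z → Pos u (at z σ)) (pebbles-v : ∀ z → Pos v (at z τ)) where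

    -- (d): the defining family of r, read at the pebble z, has depth the length of r
    equiv-pebble-ord : ∀ z r → InR* n u r →
      ordM (just (at z σ)) (eval r u) ≡ ordM (just (at z τ)) (eval r v)
    equiv-pebble-ord z r ((_ , |r|≤n) , t , eu) =
      let t' , ev = to (defined-transfer r |r|≤n) (t , eu)
          at-pebble : ∀ (w : Word k) ρ {s} → eval r w ≡ just s → Pos w (at z ρ) →
                      ∀ d → T (satAt w ρ (rankerF r d z)) ⇔ s ≺[ d ] at z ρ
          at-pebble w ρ {s} ev pz d = subst (λ ρ' → T (satAt w ρ' (rankerF r d z)) ⇔ s ≺[ d ] at z ρ) (move-at z ρ)
                                    (describe (define (ranker-defines w r ev) z ρ) d (at z ρ) pz)
          o = compare-transfer (λ d → rankerF r d z) (λ d → ≤-trans (ranker-depth r d z) |r|≤n)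
                (at-pebble u σ eu (pebbles-u z)) (at-pebble v τ ev (pebbles-v z))
      in ordM-intro eu ev (ord-swap t (at z σ) t' (at z τ) o)

    equiv-atoms : Atom u σ v τ
    equiv-atoms = letters , ord-cong (less x y) (less y x)
      where
      less : ∀ a b → at a σ < at b σ ⇔ at a τ < at b τ
      less a b = mk⇔ (λ h → <ᵇ⇒< (at a τ) (at b τ) (to (transfer (a <' b) z≤n) (<⇒<ᵇ h)))
                     (λ h → <ᵇ⇒< (at a σ) (at b σ) (from (transfer (a <' b) z≤n) (<⇒<ᵇ h)))
      letters : ∀ z → letterAt u (at z σ) ≡ letterAt v (at z τ)
      letters z = let c , lc = Pos⇒letter u (at z σ) (pebbles-u z)
                      lc' = to (isLetter⇔ v c (at z τ)) (to (transfer (Q c z) z≤n) (from (isLetter⇔ u c (at z σ)) lc))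
                  in trans lc (sym lc')

condition⇒invariant : ∀ {n} {u v : Word k} {i₁ i₂ j₁ j₂} →
  (∀ z → Pos u (at z (i₁ , i₂))) → (∀ z → Pos v (at z (j₁ , j₂))) →
  CondI n u i₁ i₂ v j₁ j₂ → Invariant n u (i₁ , i₂) v (j₁ , j₂)
condition⇒invariant pebbles-u pebbles-v (same-rankers , same-order , equiv₀ , same-pebble-order) = record
  { pebbles-u  = pebbles-u
  ; pebbles-v  = pebbles-v
  ; rankers    = same-rankers
  ; ranker-ord = same-order
  ; atoms      = equiv-atoms equiv₀ pebbles-u pebbles-v
  ; pebble-ord = λ { x r h → proj₁ (same-pebble-order r h) ; y r h → proj₂ (same-pebble-order r h) }
  }

theorem3p9 : ∀ {k : ℕ} (u v : Word k) (i₁ i₂ j₁ j₂ n : ℕ) →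
    1 ≤ i₁ → i₁ ≤ length u → 1 ≤ i₂ → i₂ ≤ length u →
    1 ≤ j₁ → j₁ ≤ length v → 1 ≤ j₂ → j₂ ≤ length v →
    CondI n u i₁ i₂ v j₁ j₂ ⇔ FOEquiv n u i₁ i₂ v j₁ j₂
theorem3p9 u v i₁ i₂ j₁ j₂ n 1≤i₁ i₁≤|u| 1≤i₂ i₂≤|u| 1≤j₁ j₁≤|v| 1≤j₂ j₂≤|v| = mk⇔
  (λ cond → game⇒equiv n (invariant⇒game n (condition⇒invariant pebbles-u pebbles-v cond)))
  (λ equiv → equiv-rankers equiv , equiv-ranker-ord equiv , (λ φ h → equiv φ (≤-trans h z≤n))
           , λ r h → equiv-pebble-ord equiv pebbles-u pebbles-v x r h , equiv-pebble-ord equiv pebbles-u pebbles-v y r h)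
  where
  pebbles-u : ∀ z → Pos u (at z (i₁ , i₂))
  pebbles-u x = 1≤i₁ , i₁≤|u|
  pebbles-u y = 1≤i₂ , i₂≤|u|
  pebbles-v : ∀ z → Pos v (at z (j₁ , j₂))
  pebbles-v x = 1≤j₁ , j₁≤|v|
  pebbles-v y = 1≤j₂ , j₂≤|v|
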